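{- Let $G$ be a connected $P_3\cup P_1$-free graph. Then $cop(G)\leq 2$.
   Context: All graphs are finite, simple and undirected. $P_n$ denotes the path on $n$ vertices; $G\cup H$ denotes the disjoint union of vertex-disjoint graphs, so $P_3\cup P_1$ is a path on three vertices plus an isolated vertex. A graph is $H$-free if it contains no induced subgraph isomorphic to $H$. Game of cops and robber on a connected graph: first all cops are placed on vertices (several may share a vertex), then the robber chooses a vertex; afterwards cops and robber move alternately, starting with the cops, a move consisting of staying put or moving to an adjacent vertex. The cops win if after finitely many rounds some cop is on the same vertex as the robber. The cop number $cop(G)$ is the minimum number of cops that guarantees a win in each connected component of $G$. -}

module Defs where

open import Data.Nat using (ℕ; suc)
open import Data.Fin using (Fin; zero; suc)
open import Data.Bool using (Bool; true; false; T)
open import Data.Product using (Σ; ∃; _×_; _,_)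
open import Data.Sum using (_⊎_)
open import Relation.Nullary using (¬_)
open import Relation.Binary.PropositionalEquality using (_≡_; refl)
open import Function.Bundles using (_⇔_)
open import Function.Definitions using (Injective)

record Graph (n : ℕ) : Set where
  field
    edge  : Fin n → Fin n → Bool
    sym   : ∀ u v → edge u v ≡ edge v u
    loopless : ∀ u → edge u u ≡ false

  Adj : Fin n → Fin n → Set
  Adj u v = T (edge u v)

open Graph public

-- Walks and connectedness (a connected graph is nonempty).
data Walk {n : ℕ} (G : Graph n) : Fin n → Fin n → Set where
  here : ∀ {u} → Walk G u u
  step : ∀ {u v w} → Adj G u v → Walk G v w → Walk G u w

Connected : ∀ {n} → Graph n → Set
Connected {n} G = Fin n × (∀ u v → Walk G u v)

p3p1-edge : Fin 4 → Fin 4 → Bool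
p3p1-edge zero (suc zero) = true
p3p1-edge (suc zero) zero = true
p3p1-edge (suc zero) (suc (suc zero)) = true
p3p1-edge (suc (suc zero)) (suc zero) = true
p3p1-edge _ _ = false

p3p1-sym : ∀ u v → p3p1-edge u v ≡ p3p1-edge v u
p3p1-sym zero zero = refl
p3p1-sym zero (suc zero) = refl
p3p1-sym zero (suc (suc zero)) = refl
p3p1-sym zero (suc (suc (suc zero))) = refl
p3p1-sym (suc zero) zero = refl
p3p1-sym (suc zero) (suc zero) = refl
p3p1-sym (suc zero) (suc (suc zero)) = refl
p3p1-sym (suc zero) (suc (suc (suc zero))) = refl
p3p1-sym (suc (suc zero)) zero = refl
p3p1-sym (suc (suc zero)) (suc zero) = refl
p3p1-sym (suc (suc zero)) (suc (suc zero)) = refl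
p3p1-sym (suc (suc zero)) (suc (suc (suc zero))) = refl
p3p1-sym (suc (suc (suc zero))) zero = refl
p3p1-sym (suc (suc (suc zero))) (suc zero) = refl
p3p1-sym (suc (suc (suc zero))) (suc (suc zero)) = refl
p3p1-sym (suc (suc (suc zero))) (suc (suc (suc zero))) = refl

p3p1-loopless : ∀ u → p3p1-edge u u ≡ false
p3p1-loopless zero = refl
p3p1-loopless (suc zero) = refl
p3p1-loopless (suc (suc zero)) = refl
p3p1-loopless (suc (suc (suc zero))) = refl

P3∪P1 : Graph 4
P3∪P1 = record { edge = p3p1-edge ; sym = p3p1-sym ; loopless = p3p1-loopless }

InducedCopy : ∀ {m n} → Graph m → Graph n → Set
InducedCopy {m} {n} H G =
  Σ (Fin m → Fin n) λ f → Injective _≡_ _≡_ f × (∀ i j → Adj H i j ⇔ Adj G (f i) (f j))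

_-free : ∀ {m} → Graph m → ∀ {n} → Graph n → Set
(H -free) G = ¬ InducedCopy H G

Step : ∀ {n} → Graph n → Fin n → Fin n → Set
Step G u v = u ≡ v ⊎ Adj G u v

Cops : ℕ → ℕ → Set
Cops k n = Fin k → Fin n

CopsStep : ∀ {n k} → Graph n → Cops k n → Cops k n → Set
CopsStep G C C' = ∀ i → Step G (C i) (C' i)

Caught : ∀ {n k} → Cops k n → Fin n → Set
Caught C r = ∃ λ i → C i ≡ r

-- CopsWin G C r : with cops at C and robber at r, cops to move, the cops can
-- force a capture after finitely many rounds (inductive = well-founded game tree).
data CopsWin {n k : ℕ} (G : Graph n) : Cops k n → Fin n → Set where
  caught : ∀ {C r} → Caught C r → CopsWin G C r
  move   : ∀ {C r} (C' : Cops k n) → CopsStep G C C' →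
           (Caught C' r ⊎ (∀ r' → Step G r r' → CopsWin G C' r')) →
           CopsWin G C r

CopsWinGame : ∀ {n} → Graph n → ℕ → Set
CopsWinGame {n} G k = Σ (Cops k n) λ C → ∀ r → CopsWin G C r

-- cop(G) ≤ k for connected G (one component).
CopNumber≤ : ∀ {n} → Graph n → ℕ → Set
CopNumber≤ G k = CopsWinGame G k

-- The first cop guards a vertex x and never moves; the robber must therefore start and stay
-- outside the closed neighbourhood N[x], or he is caught at once.  Let r₀ be his start vertex.
-- In a (P₃ ∪ P₁)-free graph N[r₀] ∖ N[x] cannot be left by a robber avoiding N[x]: a move
-- r → r′ out of N[r₀] would make r′ – r – r₀ an induced P₃ with x isolated from it.
-- So the second cop simply walks to r₀ and then has the robber within reach.
module Submission where

open import Defs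
open import Data.Nat using (ℕ)
open import Data.Fin using (Fin; zero; suc)
open import Data.Fin.Properties using (_≟_)
open import Data.Bool using (T)
open import Data.Bool.Properties using (T?)
open import Data.Unit using (tt)
open import Data.Product using (_,_)
open import Data.Sum using (inj₁; inj₂)
open import Data.Vec.Functional using (_∷_; []; updateAt)
open import Data.Vec.Functional.Properties using (updateAt-updates; updateAt-minimal)
open import Function using (const)
open import Function.Bundles using (_⇔_; mk⇔)
open import Relation.Nullary using (¬_; Dec; yes; no; contradiction)
open import Relation.Nullary.Decidable using (_⊎-dec_)
open import Relation.Nullary.Reflects using (Reflects; ofʸ; ofⁿ)
open import Relation.Binary.PropositionalEquality using (_≡_; refl; subst) renaming (sym to ≡-sym)

Reflects⇒T⇔ : ∀ {a} {A : Set a} {b} → Reflects A b → T b ⇔ A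
Reflects⇒T⇔ (ofʸ a)  = mk⇔ (const a) (const tt)
Reflects⇒T⇔ (ofⁿ ¬a) = mk⇔ (λ ()) ¬a

module _ {n : ℕ} (G : Graph n) where

  Adj-sym : ∀ {u v} → Adj G u v → Adj G v u
  Adj-sym {u} {v} = subst T (Graph.sym G u v)

  Adj-irrefl : ∀ {u} → ¬ Adj G u u
  Adj-irrefl {u} = subst T (loopless G u)

  Adj⇒≢ : ∀ {u v} → Adj G u v → ¬ u ≡ v
  Adj⇒≢ uv refl = Adj-irrefl uv

  Step-sym : ∀ {u v} → Step G u v → Step G v u
  Step-sym (inj₁ u≡v) = inj₁ (≡-sym u≡v)
  Step-sym (inj₂ uv)  = inj₂ (Adj-sym uv)

  Step? : ∀ u v → Dec (Step G u v)
  Step? u v = (u ≟ v) ⊎-dec T? (edge G u v)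

  induced-P3∪P1 : ∀ {a b c d} → Adj G a b → Adj G b c → ¬ Step G a c →
                  ¬ Step G d a → ¬ Step G d b → ¬ Step G d c → InducedCopy P3∪P1 G
  induced-P3∪P1 {a} {b} {c} {d} ab bc ¬ac ¬da ¬db ¬dc = f , (λ {i} {j} → injective i j) , adjacency
    where
    f : Fin 4 → Fin n
    f zero                   = a
    f (suc zero)             = b
    f (suc (suc zero))       = c
    f (suc (suc (suc zero))) = d

    a≢c : ¬ a ≡ c
    a≢c a≡c = ¬ac (inj₁ a≡c)

    d≢_ : ∀ {v} → ¬ Step G d v → ¬ d ≡ v
    (d≢ ¬dv) d≡v = ¬dv (inj₁ d≡v)

    ¬Adj_ : ∀ {u v} → ¬ Step G u v → ¬ Adj G u v
    (¬Adj ¬uv) uv = ¬uv (inj₂ uv)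

    ¬Adj⁻¹ : ∀ {u v} → ¬ Step G u v → ¬ Adj G v u
    ¬Adj⁻¹ ¬uv vu = ¬uv (inj₂ (Adj-sym vu))

    injective : ∀ i j → f i ≡ f j → i ≡ j
    injective zero                   zero                   _ = refl
    injective zero                   (suc zero)             e = contradiction e (Adj⇒≢ ab)
    injective zero                   (suc (suc zero))       e = contradiction e a≢c
    injective zero                   (suc (suc (suc zero))) e = contradiction (≡-sym e) (d≢ ¬da)
    injective (suc zero)             zero                   e = contradiction (≡-sym e) (Adj⇒≢ ab)
    injective (suc zero)             (suc zero)             _ = refl
    injective (suc zero)             (suc (suc zero))       e = contradiction e (Adj⇒≢ bc)
    injective (suc zero)             (suc (suc (suc zero))) e = contradiction (≡-sym e) (d≢ ¬db)
    injective (suc (suc zero))       zero                   e = contradiction (≡-sym e) a≢c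
    injective (suc (suc zero))       (suc zero)             e = contradiction (≡-sym e) (Adj⇒≢ bc)
    injective (suc (suc zero))       (suc (suc zero))       _ = refl
    injective (suc (suc zero))       (suc (suc (suc zero))) e = contradiction (≡-sym e) (d≢ ¬dc)
    injective (suc (suc (suc zero))) zero                   e = contradiction e (d≢ ¬da)
    injective (suc (suc (suc zero))) (suc zero)             e = contradiction e (d≢ ¬db)
    injective (suc (suc (suc zero))) (suc (suc zero))       e = contradiction e (d≢ ¬dc)
    injective (suc (suc (suc zero))) (suc (suc (suc zero))) _ = refl

    reflects : ∀ i j → Reflects (Adj G (f i) (f j)) (Graph.edge P3∪P1 i j)
    reflects zero                   zero                   = ofⁿ Adj-irrefl
    reflects zero                   (suc zero)             = ofʸ ab
    reflects zero                   (suc (suc zero))       = ofⁿ (¬Adj ¬ac)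
    reflects zero                   (suc (suc (suc zero))) = ofⁿ (¬Adj⁻¹ ¬da)
    reflects (suc zero)             zero                   = ofʸ (Adj-sym ab)
    reflects (suc zero)             (suc zero)             = ofⁿ Adj-irrefl
    reflects (suc zero)             (suc (suc zero))       = ofʸ bc
    reflects (suc zero)             (suc (suc (suc zero))) = ofⁿ (¬Adj⁻¹ ¬db)
    reflects (suc (suc zero))       zero                   = ofⁿ (¬Adj⁻¹ ¬ac)
    reflects (suc (suc zero))       (suc zero)             = ofʸ (Adj-sym bc)
    reflects (suc (suc zero))       (suc (suc zero))       = ofⁿ Adj-irrefl
    reflects (suc (suc zero))       (suc (suc (suc zero))) = ofⁿ (¬Adj⁻¹ ¬dc)
    reflects (suc (suc (suc zero))) zero                   = ofⁿ (¬Adj ¬da)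
    reflects (suc (suc (suc zero))) (suc zero)             = ofⁿ (¬Adj ¬db)
    reflects (suc (suc (suc zero))) (suc (suc zero))       = ofⁿ (¬Adj ¬dc)
    reflects (suc (suc (suc zero))) (suc (suc (suc zero))) = ofⁿ Adj-irrefl

    adjacency : ∀ i j → Adj P3∪P1 i j ⇔ Adj G (f i) (f j)
    adjacency i j = Reflects⇒T⇔ (reflects i j)

  within-reach : ∀ {k} {C : Cops k n} {r} i → Step G (C i) r → CopsWin G C r
  within-reach {k} {C} {r} i Cir = move C′ moves (inj₁ (i , updateAt-updates i C))
    where
    C′ : Cops k n
    C′ = updateAt C i (const r)

    moves : CopsStep G C C′
    moves j with j ≟ i
    ... | yes refl = subst (Step G (C j)) (≡-sym (updateAt-updates j C)) Cir
    ... | no j≢i   = inj₁ (≡-sym (updateAt-minimal j i C j≢i))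

  module _ (free : (P3∪P1 -free) G) {x r₀ : Fin n} (¬xr₀ : ¬ Step G x r₀) where

    robber-trapped : ∀ {r r′} → Step G r r₀ → ¬ Step G x r → Step G r r′ → ¬ Step G x r′ →
                     Step G r′ r₀
    robber-trapped (inj₁ refl) _   rr′          _    = Step-sym rr′
    robber-trapped (inj₂ rr₀)  _   (inj₁ refl)  _    = inj₂ rr₀
    robber-trapped {r′ = r′} (inj₂ rr₀) ¬xr (inj₂ rr′) ¬xr′ with Step? r′ r₀
    ... | yes r′r₀ = r′r₀
    ... | no ¬r′r₀ = contradiction (induced-P3∪P1 (Adj-sym rr′) rr₀ ¬r′r₀ ¬xr′ ¬xr ¬xr₀) free

    guard-and-chase : ∀ {c r} → Walk G c r₀ → Step G r r₀ → ¬ Step G x r →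
                      CopsWin G (x ∷ c ∷ []) r
    guard-and-chase here rr₀ _ = within-reach (suc zero) (Step-sym rr₀)
    guard-and-chase {c} {r} (step {v = v} cv walk) rr₀ ¬xr =
      move (x ∷ v ∷ []) chaser-moves (inj₂ respond)
      where
      chaser-moves : CopsStep G (x ∷ c ∷ []) (x ∷ v ∷ [])
      chaser-moves zero       = inj₁ refl
      chaser-moves (suc zero) = inj₂ cv

      respond : ∀ r′ → Step G r r′ → CopsWin G (x ∷ v ∷ []) r′
      respond r′ rr′ with Step? x r′
      ... | yes xr′ = within-reach zero xr′
      ... | no ¬xr′ = guard-and-chase walk (robber-trapped rr₀ ¬xr rr′ ¬xr′) ¬xr′

theorem5p1 : ∀ (n : ℕ) (G : Graph n) → Connected G → (P3∪P1 -free) G → CopNumber≤ G 2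
theorem5p1 n G (x , walk) free = x ∷ x ∷ [] , start
  where
  start : ∀ r → CopsWin G (x ∷ x ∷ []) r
  start r with Step? G x r
  ... | yes xr = within-reach G zero xr
  ... | no ¬xr = guard-and-chase G free ¬xr (walk x r) (inj₁ refl) ¬xr
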